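{- Let the Schröder slicings grow as follows. The root is the single cell. The children of a Schröder slicing $P$ are the Schröder slicings obtained from $P$ in one of two ways: - by adding a new horizontal block as a new topmost row, right-aligned with the right side of the bounding rectangle of $P$; - by adding a new vertical block as a new rightmost column, top-aligned with the top of the bounding rectangle of $P$ (of any height from $1$ to the height of the rightmost column of $P$). Label each Schröder slicing by $(h,k)$, where $h$ is the maximal width of a horizontal block that can be added while remaining a Schröder slicing and $k$ is the height of its rightmost column. Then the root has label $(1,1)$, and a slicing with label $(h,k)$ has children with labels exactly $$(1,k+1),\ldots,(h,k+1),\ (2,1),\ldots,(2,k-1),\ (h+1,k).$$ Hence the generating tree of Schröder slicings is the tree $\mathcal{T}_{\mathrm{Sch}}$ of this succession rule (NewSch), and Schröder slicings are counted by the large Schröder numbers.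
   Context: A parallelogram polyomino is an edge-connected set of unit cells of the plane forming the interior of a contour made of two lattice paths with unit steps $(0,1)$ and $(1,0)$. The two paths meet only at their common start and at their common end. The size is $k+\ell-1$ for a $k\times\ell$ bounding rectangle. A Baxter slicing of size $n$ is a parallelogram polyomino $P$ of size $n$ whose interior is divided into $n$ blocks, defined recursively: - for $n=1$, the single cell is the single block; - for $n\ge2$, one block is either the topmost row of $P$ (a horizontal block) or the rightmost column of $P$ (a vertical block), and the remaining $n-1$ blocks form a Baxter slicing of the polyomino obtained by deleting that row, respectively that column. For a horizontal block $u$ of a Baxter slicing of $P$: - $\ell(u)$ is the width of $u$; - $X(u)$ is the lowest point of the lower border of $P$ whose abscissa equals that of the right edge of $u$; - $r(u)$ is the number of horizontal steps of the lower border of $P$ read leftwards from $X(u)$ before a vertical step or the bottom-left corner of $P$ is met. A Schröder slicing is a Baxter slicing in which every horizontal block $u$ satisfies $\ell(u)\le r(u)+1$. The large Schröder numbers $1,2,6,22,90,\ldots$ (for sizes $1,2,\ldots$) have generating function $\sum_{n\ge1}S_nx^{n-1}=(1-x-\sqrt{1-6x+x^2})/(2x)$. -}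

module Defs where

open import Data.Nat using (ℕ; zero; suc; _+_; _*_; _∸_; _≤_)
open import Data.Nat.Properties using (_≟_)
open import Data.Product using (_×_; _,_; proj₁; proj₂; Σ; ∃-syntax)
open import Data.Sum using (_⊎_)
open import Data.List using (List; []; _∷_; _++_; length; map; filter; reverse; replicate; zipWith; upTo)
open import Data.Nat.ListAction using (sum)
open import Data.List.Relation.Unary.All using (All)
open import Relation.Binary.PropositionalEquality using (_≡_)

-- Parallelogram polyominoes, positioned with bottom-left corner at the
-- origin, are described by their list of columns from left to right;
-- a column (b , t) consists of the cells [x,x+1) × [y,y+1) with b ≤ y < t.

Column : Set
Column = ℕ × ℕ

lastTop : List Column → ℕ
lastTop []            = 0
lastTop ((b , t) ∷ []) = t
lastTop (_ ∷ c ∷ cs)  = lastTop (c ∷ cs)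

lastHeight : List Column → ℕ
lastHeight []            = 0
lastHeight ((b , t) ∷ []) = t ∸ b
lastHeight (_ ∷ c ∷ cs)  = lastHeight (c ∷ cs)

raiseFirst : ℕ → List Column → List Column
raiseFirst zero    cs             = cs
raiseFirst (suc w) []             = []
raiseFirst (suc w) ((b , t) ∷ cs) = (b , suc t) ∷ raiseFirst w cs

raiseLast : ℕ → List Column → List Column
raiseLast w cs = reverse (raiseFirst w (reverse cs))

-- Baxter slicings, described through the recursive definition:
-- a slicing of size n ≥ 2 is a slicing s of size n-1 together with
-- its last block, which is either the topmost row (H w s: a horizontal
-- block of width w) or the rightmost column (V h s: a vertical block of
-- height h) of the resulting polyomino.

data Slicing : Set where
  cell : Slicing
  H    : ℕ → Slicing → Slicing
  V    : ℕ → Slicing → Slicing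

mutual
  cols : Slicing → List Column
  cols cell    = (0 , 1) ∷ []
  cols (H w s) = raiseLast w (cols s)
  cols (V h s) = cols s ++ ((height s ∸ h) , height s) ∷ []

  height : Slicing → ℕ
  height s = lastTop (cols s)

width : Slicing → ℕ
width s = length (cols s)

size : Slicing → ℕ
size s = width s + height s ∸ 1

topRowWidth : Slicing → ℕ
topRowWidth s = length (filter (λ c → proj₂ c ≟ height s) (cols s))

rightColHeight : Slicing → ℕ
rightColHeight s = lastHeight (cols s)

-- validity: the new top row (right-aligned) must sit on top of the
-- current topmost row, the new rightmost column (top-aligned) must be
-- no taller than the current rightmost column; otherwise the result is
-- not a parallelogram polyomino of size one more.
data Baxter : Slicing → Set where
  cellB : Baxter cell
  hB    : ∀ {w s} → Baxter s → 1 ≤ w → w ≤ topRowWidth s → Baxter (H w s)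
  vB    : ∀ {h s} → Baxter s → 1 ≤ h → h ≤ rightColHeight s → Baxter (V h s)

-- Lower border of the polyomino, as a lattice path from the bottom-left
-- corner (0,0) to the top-right corner.

data Step : Set where
  E N : Step

lb : ℕ → List Column → List Step
lb y []                  = []
lb y ((b , t) ∷ [])      = replicate (b ∸ y) N ++ E ∷ replicate (t ∸ b) N
lb y ((b , t) ∷ c ∷ cs)  = replicate (b ∸ y) N ++ E ∷ lb b (c ∷ cs)

lowerBorder : Slicing → List Step
lowerBorder s = lb 0 (cols s)

-- prefix of a path up to (and including) its x-th E step; for x ≥ 1
-- its endpoint is the lowest point of the path with abscissa x
prefixToAbscissa : ℕ → List Step → List Step
prefixToAbscissa zero    _        = []
prefixToAbscissa (suc x) []       = []
prefixToAbscissa (suc x) (E ∷ ps) = E ∷ prefixToAbscissa x ps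
prefixToAbscissa (suc x) (N ∷ ps) = N ∷ prefixToAbscissa (suc x) ps

leadingE : List Step → ℕ
leadingE []       = 0
leadingE (E ∷ ps) = suc (leadingE ps)
leadingE (N ∷ ps) = 0

-- r for a horizontal block whose right edge has abscissa x:
-- number of horizontal steps of the lower border read leftwards from
-- X = lowest point of the lower border with abscissa x, before a
-- vertical step or the bottom-left corner is met
rAt : Slicing → ℕ → ℕ
rAt s x = leadingE (reverse (prefixToAbscissa x (lowerBorder s)))

-- horizontal blocks of a slicing, as pairs (width ℓ(u), abscissa of right edge of u)
hblocks : Slicing → List (ℕ × ℕ)
hblocks cell    = []
hblocks (H w s) = (w , width s) ∷ hblocks s
hblocks (V h s) = hblocks s

-- Schröder slicings: every horizontal block u satisfies ℓ(u) ≤ r(u) + 1,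
-- where r is computed in the (whole) slicing s
Schroder : Slicing → Set
Schroder s = Baxter s × All (λ u → proj₁ u ≤ suc (rAt s (proj₂ u))) (hblocks s)

GrowsFrom : Slicing → Slicing → Set
GrowsFrom P c = (∃[ w ] c ≡ H w P) ⊎ (∃[ h ] c ≡ V h P)

MaxHorizontal : Slicing → ℕ → Set
MaxHorizontal P h = Schroder (H h P) × (∀ w → Schroder (H w P) → w ≤ h)

Label : Slicing → ℕ → ℕ → Set
Label P h k = MaxHorizontal P h × k ≡ rightColHeight P

newSch : ℕ → ℕ → List (ℕ × ℕ)
newSch h k = map (λ i → (suc i , suc k)) (upTo h)
          ++ map (λ j → (2 , suc j)) (upTo (k ∸ 1))
          ++ (suc h , k) ∷ []

-- Large Schröder numbers: with G(x) = Σ_{n≥0} r_n x^n the series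
-- (1-x-√(1-6x+x²))/(2x), G = 1 + xG + xG², i.e. r_0 = 1 and
-- r_{n+1} = r_n + Σ_{i=0}^{n} r_i r_{n-i}.  S_{n+1} = r_n.

headOr : List ℕ → ℕ
headOr []      = 0
headOr (x ∷ _) = x

-- r_n ∷ r_{n-1} ∷ … ∷ r_0
schroderUpTo : ℕ → List ℕ
schroderUpTo zero    = 1 ∷ []
schroderUpTo (suc n) =
  (headOr (schroderUpTo n) + sum (zipWith _*_ (schroderUpTo n) (reverse (schroderUpTo n))))
  ∷ schroderUpTo n

-- large Schröder number S_n for sizes n ≥ 1 (S_0 := 0, unused)
LargeSchroder : ℕ → ℕ
LargeSchroder zero    = 0
LargeSchroder (suc n) = headOr (schroderUpTo n)

module Submission where

-- Every Baxter slicing of height T has as its top row a nonempty final run of columns of top T;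
-- this invariant tracks how the width of the top row, the height of the rightmost column and the
-- size change when a block is added. Adding a block leaves the lower border under the existing
-- horizontal blocks unchanged, so the Schröder condition only has to be checked for the new block,
-- against r at the right side of the rectangle: a new row leaves that r unchanged, and a new column
-- turns it into r + 1 or 1 according as it has full or smaller height. This yields the labels of
-- the children, i.e. the rule (NewSch).
--
-- For counting, a label (h , k) only matters through j = (h - 1) + (k - 1), whose children carry
-- 1, …, j + 1, j + 1. If F j is the generating function of the descendants of a node labelled j,
-- induction on the coefficients gives F (j + 2) = F (j + 1) (1 + x F 1), hence
-- F 1 = 1 + 3 x F 1 + 2 x² (F 1)², and R = F 0 = 1 + 2 x F 1 satisfies R = 1 + x R + x R²,
-- the equation of the large Schröder numbers.

open import Defs
open import Data.Nat
open import Data.Nat.Properties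
open import Data.Nat.Tactic.RingSolver using (solve-∀)
open import Data.Nat.ListAction using (sum)
open import Data.Nat.ListAction.Properties using (sum-++)
open import Data.Product using (_×_; _,_; proj₁; proj₂; ∃-syntax; ∃₂)
open import Data.Sum using (inj₁; inj₂)
open import Data.Empty using (⊥; ⊥-elim)
open import Data.List
  using (List; []; _∷_; _++_; length; map; filter; reverse; replicate; take; drop; zipWith;
         upTo; applyUpTo; applyDownFrom; concatMap)
open import Data.List.Properties
  using (++-assoc; ++-identityʳ; map-++; map-∘; map-upTo; length-++; length-map; length-reverse; length-drop;
         take++drop≡id; reverse-++; reverse-involutive; reverse-map; reverse-applyDownFrom;
         filter-++; filter-all; filter-none)
open import Data.List.Relation.Unary.All as All using (All; []; _∷_)
import Data.List.Relation.Unary.All.Properties as All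
open import Data.List.Relation.Unary.Any using (here)
open import Data.List.Relation.Unary.AllPairs using ([]; _∷_)
open import Data.List.Membership.Propositional using (_∈_; find; lose)
open import Data.List.Membership.Propositional.Properties
  using (∈-map⁺; ∈-map⁻; ∈-++⁺ˡ; ∈-++⁺ʳ; ∈-++⁻; ∈-upTo⁺; ∈-upTo⁻; ∈-concatMap⁺; ∈-concatMap⁻)
open import Data.List.Relation.Unary.Unique.Propositional using (Unique)
import Data.List.Relation.Unary.Unique.Propositional.Properties as Unique
open import Data.List.Relation.Binary.Pointwise as Pointwise using (Pointwise; []; _∷_; Pointwise-≡⇒≡)
open import Data.List.Relation.Binary.Permutation.Propositional using (_↭_; ↭-refl)
open import Function using (_∘_; _∘′_)
open import Function.Bundles using (_⇔_; mk⇔)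
open import Relation.Binary.PropositionalEquality
open ≡-Reasoning

raiseTop : Column → Column
raiseTop (b , t) = b , suc t

raiseFirst-++ : ∀ (xs ys : List Column) → raiseFirst (length xs) (xs ++ ys) ≡ map raiseTop xs ++ ys
raiseFirst-++ []            ys = refl
raiseFirst-++ ((b , t) ∷ xs) ys = cong ((b , suc t) ∷_) (raiseFirst-++ xs ys)

raiseLast-++ : ∀ (xs ys : List Column) → raiseLast (length ys) (xs ++ ys) ≡ xs ++ map raiseTop ys
raiseLast-++ xs ys = begin
  reverse (raiseFirst (length ys) (reverse (xs ++ ys)))
    ≡⟨ cong (λ zs → reverse (raiseFirst (length ys) zs)) (reverse-++ xs ys) ⟩
  reverse (raiseFirst (length ys) (reverse ys ++ reverse xs))
    ≡⟨ cong (λ k → reverse (raiseFirst k (reverse ys ++ reverse xs))) (sym (length-reverse ys)) ⟩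
  reverse (raiseFirst (length (reverse ys)) (reverse ys ++ reverse xs))
    ≡⟨ cong reverse (raiseFirst-++ (reverse ys) (reverse xs)) ⟩
  reverse (map raiseTop (reverse ys) ++ reverse xs)
    ≡⟨ reverse-++ (map raiseTop (reverse ys)) (reverse xs) ⟩
  reverse (reverse xs) ++ reverse (map raiseTop (reverse ys))
    ≡⟨ cong₂ _++_ (reverse-involutive xs) (cong reverse (reverse-map raiseTop ys)) ⟩
  xs ++ reverse (reverse (map raiseTop ys))
    ≡⟨ cong (xs ++_) (reverse-involutive (map raiseTop ys)) ⟩
  xs ++ map raiseTop ys ∎

length-raiseFirst : ∀ w cs → length (raiseFirst w cs) ≡ length cs
length-raiseFirst zero    cs            = refl
length-raiseFirst (suc w) []            = refl
length-raiseFirst (suc w) ((b , t) ∷ cs) = cong suc (length-raiseFirst w cs)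

length-raiseLast : ∀ w cs → length (raiseLast w cs) ≡ length cs
length-raiseLast w cs =
  trans (length-reverse (raiseFirst w (reverse cs))) (trans (length-raiseFirst w (reverse cs)) (length-reverse cs))

bottoms-raiseFirst : ∀ w cs → map proj₁ (raiseFirst w cs) ≡ map proj₁ cs
bottoms-raiseFirst zero    cs            = refl
bottoms-raiseFirst (suc w) []            = refl
bottoms-raiseFirst (suc w) ((b , t) ∷ cs) = cong (b ∷_) (bottoms-raiseFirst w cs)

bottoms-raiseLast : ∀ w cs → map proj₁ (raiseLast w cs) ≡ map proj₁ cs
bottoms-raiseLast w cs = begin
  map proj₁ (reverse (raiseFirst w (reverse cs)))    ≡⟨ reverse-map proj₁ (raiseFirst w (reverse cs)) ⟩
  reverse (map proj₁ (raiseFirst w (reverse cs)))    ≡⟨ cong reverse (bottoms-raiseFirst w (reverse cs)) ⟩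
  reverse (map proj₁ (reverse cs))                   ≡⟨ cong reverse (reverse-map proj₁ cs) ⟩
  reverse (reverse (map proj₁ cs))                   ≡⟨ reverse-involutive (map proj₁ cs) ⟩
  map proj₁ cs                                       ∎

-- (0 , 0) on [] is a junk value: every polyomino has a column.
lastColumn : List Column → Column
lastColumn []           = 0 , 0
lastColumn (c ∷ [])     = c
lastColumn (_ ∷ d ∷ cs) = lastColumn (d ∷ cs)

lastTop≡ : ∀ cs → lastTop cs ≡ proj₂ (lastColumn cs)
lastTop≡ []            = refl
lastTop≡ ((b , t) ∷ []) = refl
lastTop≡ (_ ∷ c ∷ cs)  = lastTop≡ (c ∷ cs)

lastHeight≡ : ∀ cs → lastHeight cs ≡ proj₂ (lastColumn cs) ∸ proj₁ (lastColumn cs)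
lastHeight≡ []            = refl
lastHeight≡ ((b , t) ∷ []) = refl
lastHeight≡ (_ ∷ c ∷ cs)  = lastHeight≡ (c ∷ cs)

lastColumn-++ : ∀ xs y ys → lastColumn (xs ++ y ∷ ys) ≡ lastColumn (y ∷ ys)
lastColumn-++ []            y ys = refl
lastColumn-++ (x ∷ [])      y ys = refl
lastColumn-++ (x ∷ x′ ∷ xs) y ys = lastColumn-++ (x′ ∷ xs) y ys

lastColumn-map : ∀ (f : Column → Column) y ys → lastColumn (map f (y ∷ ys)) ≡ f (lastColumn (y ∷ ys))
lastColumn-map f y []        = refl
lastColumn-map f y (y′ ∷ ys) = lastColumn-map f y′ ys

All-lastColumn : ∀ {P : Column → Set} y ys → All P (y ∷ ys) → P (lastColumn (y ∷ ys))
All-lastColumn y []        (p ∷ []) = p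
All-lastColumn y (y′ ∷ ys) (_ ∷ ps) = All-lastColumn y′ ys ps

record TopRow (cs : List Column) (T : ℕ) : Set where
  field
    lower        : List Column
    first        : Column
    rest         : List Column
    split        : cs ≡ lower ++ first ∷ rest
    lower<T      : All (λ c → proj₂ c < T) lower
    run≡T        : All (λ c → proj₂ c ≡ T) (first ∷ rest)
    lastBottom≤T : proj₁ (lastColumn cs) ≤ T

module _ {cs T} (top : TopRow cs T) where
  open TopRow top

  TopRow⇒lastColumn : lastColumn cs ≡ lastColumn (first ∷ rest)
  TopRow⇒lastColumn = trans (cong lastColumn split) (lastColumn-++ lower first rest)

  TopRow⇒lastTop : lastTop cs ≡ T
  TopRow⇒lastTop = trans (lastTop≡ cs)
    (trans (cong proj₂ TopRow⇒lastColumn) (All-lastColumn {λ c → proj₂ c ≡ T} first rest run≡T))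

  TopRow⇒topRowLength : length (filter (λ c → proj₂ c ≟ T) cs) ≡ length (first ∷ rest)
  TopRow⇒topRowLength = begin
    length (filter (λ c → proj₂ c ≟ T) cs)
      ≡⟨ cong (length ∘ filter (λ c → proj₂ c ≟ T)) split ⟩
    length (filter (λ c → proj₂ c ≟ T) (lower ++ first ∷ rest))
      ≡⟨ cong length (filter-++ (λ c → proj₂ c ≟ T) lower (first ∷ rest)) ⟩
    length (filter (λ c → proj₂ c ≟ T) lower ++ filter (λ c → proj₂ c ≟ T) (first ∷ rest))
      ≡⟨ cong₂ (λ xs ys → length (xs ++ ys))
               (filter-none (λ c → proj₂ c ≟ T) (All.map <⇒≢ lower<T))
               (filter-all (λ c → proj₂ c ≟ T) run≡T) ⟩
    length (first ∷ rest) ∎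

  TopRow⇒nonempty : 1 ≤ length cs
  TopRow⇒nonempty = subst (λ xs → 1 ≤ length xs) (sym split) (nonempty lower)
    where
    nonempty : ∀ xs → 1 ≤ length (xs ++ first ∷ rest)
    nonempty []       = s≤s z≤n
    nonempty (_ ∷ xs) = s≤s z≤n

lastColumn-++-raiseTop : ∀ xs z zs → lastColumn (xs ++ map raiseTop (z ∷ zs)) ≡ raiseTop (lastColumn (z ∷ zs))
lastColumn-++-raiseTop xs z zs = trans (lastColumn-++ xs (raiseTop z) (map raiseTop zs)) (lastColumn-map raiseTop z zs)

lastHeight-raiseTop : ∀ xs z zs → proj₁ (lastColumn (z ∷ zs)) ≤ proj₂ (lastColumn (z ∷ zs)) →
  lastHeight (xs ++ map raiseTop (z ∷ zs)) ≡ suc (lastHeight (xs ++ z ∷ zs))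
lastHeight-raiseTop xs z zs b≤t = begin
  lastHeight (xs ++ map raiseTop (z ∷ zs))
    ≡⟨ lastHeight≡ (xs ++ map raiseTop (z ∷ zs)) ⟩
  proj₂ (lastColumn (xs ++ map raiseTop (z ∷ zs))) ∸ proj₁ (lastColumn (xs ++ map raiseTop (z ∷ zs)))
    ≡⟨ cong (λ c → proj₂ c ∸ proj₁ c) (lastColumn-++-raiseTop xs z zs) ⟩
  suc (proj₂ l) ∸ proj₁ l
    ≡⟨ +-∸-assoc 1 b≤t ⟩
  suc (proj₂ l ∸ proj₁ l)
    ≡⟨ cong (λ c → suc (proj₂ c ∸ proj₁ c)) (lastColumn-++ xs z zs) ⟨
  suc (proj₂ (lastColumn (xs ++ z ∷ zs)) ∸ proj₁ (lastColumn (xs ++ z ∷ zs)))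
    ≡⟨ cong suc (lastHeight≡ (xs ++ z ∷ zs)) ⟨
  suc (lastHeight (xs ++ z ∷ zs)) ∎
  where
  l = lastColumn (z ∷ zs)

suffixOfLength : ∀ {A : Set} (xs : List A) w → w ≤ length xs → ∃₂ λ ys zs → xs ≡ ys ++ zs × length zs ≡ w
suffixOfLength xs w w≤ = take d xs , drop d xs , sym (take++drop≡id d xs) , trans (length-drop d xs) (m∸[m∸n]≡n w≤)
  where
  d = length xs ∸ w

record AddRow (s : Slicing) (w : ℕ) : Set where
  field
    topRow         : TopRow (cols (H w s)) (height (H w s))
    height≡        : height (H w s) ≡ suc (height s)
    topRowWidth≡   : topRowWidth (H w s) ≡ w
    rightColHeight≡ : rightColHeight (H w s) ≡ suc (rightColHeight s)

addRow : ∀ s w → TopRow (cols s) (height s) → 1 ≤ w → w ≤ topRowWidth s → AddRow s w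
addRow s w top 1≤w w≤t = go (suffixOfLength (first ∷ rest) w (subst (w ≤_) (TopRow⇒topRowLength top) w≤t))
  where
  open TopRow top
  T = height s
  go : ∃₂ (λ ys zs → first ∷ rest ≡ ys ++ zs × length zs ≡ w) → AddRow s w
  go (ys , []     , _     , refl) = ⊥-elim (1+n≰n 1≤w)
  go (ys , z ∷ zs , split′ , len) = record
    { topRow = subst (TopRow (cols (H w s))) (sym height≡) top′ ; height≡ = height≡
    ; topRowWidth≡ = topRowWidth≡ ; rightColHeight≡ = rightColHeight≡ }
    where
    run : All (λ c → proj₂ c ≡ T) (ys ++ z ∷ zs)
    run = subst (All (λ c → proj₂ c ≡ T)) split′ run≡T
    colsS : cols s ≡ (lower ++ ys) ++ z ∷ zs
    colsS = trans split (trans (cong (lower ++_) split′) (sym (++-assoc lower ys (z ∷ zs))))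
    colsH : cols (H w s) ≡ (lower ++ ys) ++ map raiseTop (z ∷ zs)
    colsH = trans (cong₂ raiseLast (sym len) colsS) (raiseLast-++ (lower ++ ys) (z ∷ zs))
    lastBottom≤ : proj₁ (lastColumn (z ∷ zs)) ≤ T
    lastBottom≤ = subst (λ c → proj₁ c ≤ T) (trans (cong lastColumn colsS) (lastColumn-++ (lower ++ ys) z zs)) lastBottom≤T
    top′ : TopRow (cols (H w s)) (suc T)
    top′ = record
      { lower = lower ++ ys ; first = raiseTop z ; rest = map raiseTop zs ; split = colsH
      ; lower<T = All.++⁺ (All.map m<n⇒m<1+n lower<T) (All.map (s≤s ∘ ≤-reflexive) (All.++⁻ˡ ys run))
      ; run≡T = All.map⁺ (All.map (cong suc) (All.++⁻ʳ ys run))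
      ; lastBottom≤T = subst (λ c → proj₁ c ≤ suc T) (sym (trans (cong lastColumn colsH) (lastColumn-++-raiseTop (lower ++ ys) z zs)))
                             (m≤n⇒m≤1+n lastBottom≤) }
    height≡ : height (H w s) ≡ suc T
    height≡ = TopRow⇒lastTop top′
    topRowWidth≡ : topRowWidth (H w s) ≡ w
    topRowWidth≡ = trans (cong (λ h → length (filter (λ c → proj₂ c ≟ h) (cols (H w s)))) height≡)
                         (trans (TopRow⇒topRowLength top′) (trans (length-map raiseTop (z ∷ zs)) len))
    bottom≤top : proj₁ (lastColumn (z ∷ zs)) ≤ proj₂ (lastColumn (z ∷ zs))
    bottom≤top = subst (_ ≤_) (sym (All-lastColumn {λ c → proj₂ c ≡ T} z zs (All.++⁻ʳ ys run))) lastBottom≤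
    rightColHeight≡ : rightColHeight (H w s) ≡ suc (rightColHeight s)
    rightColHeight≡ = trans (cong lastHeight colsH)
      (trans (lastHeight-raiseTop (lower ++ ys) z zs bottom≤top) (cong (suc ∘ lastHeight) (sym colsS)))

rightColHeight≤height : ∀ s → rightColHeight s ≤ height s
rightColHeight≤height s = subst₂ _≤_ (sym (lastHeight≡ (cols s))) (sym (lastTop≡ (cols s)))
  (m∸n≤m (proj₂ (lastColumn (cols s))) (proj₁ (lastColumn (cols s))))

record AddColumn (s : Slicing) (v : ℕ) : Set where
  field
    topRow          : TopRow (cols (V v s)) (height (V v s))
    height≡         : height (V v s) ≡ height s
    topRowWidth≡    : topRowWidth (V v s) ≡ suc (topRowWidth s)
    rightColHeight≡ : rightColHeight (V v s) ≡ v

addColumn : ∀ s v → TopRow (cols s) (height s) → v ≤ rightColHeight s → AddColumn s v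
addColumn s v top v≤k = record
  { topRow = subst (TopRow (cols (V v s))) (sym height≡) top′ ; height≡ = height≡
  ; topRowWidth≡ = topRowWidth≡ ; rightColHeight≡ = rightColHeight≡ }
  where
  open TopRow top
  T = height s
  new = T ∸ v , T
  lastV : lastColumn (cols (V v s)) ≡ new
  lastV = lastColumn-++ (cols s) new []
  top′ : TopRow (cols (V v s)) T
  top′ = record
    { lower = lower ; first = first ; rest = rest ++ new ∷ []
    ; split = trans (cong (_++ new ∷ []) split) (++-assoc lower (first ∷ rest) (new ∷ []))
    ; lower<T = lower<T
    ; run≡T = All.++⁺ run≡T (refl ∷ [])
    ; lastBottom≤T = subst (λ c → proj₁ c ≤ T) (sym lastV) (m∸n≤m T v) }
  height≡ : height (V v s) ≡ T
  height≡ = TopRow⇒lastTop top′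
  topRowWidth≡ : topRowWidth (V v s) ≡ suc (topRowWidth s)
  topRowWidth≡ = begin
    topRowWidth (V v s)                     ≡⟨ cong (λ h → length (filter (λ c → proj₂ c ≟ h) (cols (V v s)))) height≡ ⟩
    length (filter (λ c → proj₂ c ≟ T) (cols (V v s)))    ≡⟨ TopRow⇒topRowLength top′ ⟩
    suc (length (rest ++ new ∷ []))           ≡⟨ cong suc (trans (length-++ rest) (+-comm (length rest) 1)) ⟩
    suc (length (first ∷ rest))             ≡⟨ cong suc (TopRow⇒topRowLength top) ⟨
    suc (topRowWidth s)                     ∎
  rightColHeight≡ : rightColHeight (V v s) ≡ v
  rightColHeight≡ = trans (lastHeight≡ (cols (V v s)))
    (trans (cong (λ c → proj₂ c ∸ proj₁ c) lastV) (m∸[m∸n]≡n (≤-trans v≤k (rightColHeight≤height s))))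

baxter⇒TopRow : ∀ {s} → Baxter s → TopRow (cols s) (height s)
baxter⇒TopRow cellB = record
  { lower = [] ; first = 0 , 1 ; rest = [] ; split = refl ; lower<T = [] ; run≡T = refl ∷ [] ; lastBottom≤T = z≤n }
baxter⇒TopRow {H w s} (hB b 1≤w w≤t) = AddRow.topRow (addRow s w (baxter⇒TopRow b) 1≤w w≤t)
baxter⇒TopRow {V v s} (vB b 1≤v v≤k) = AddColumn.topRow (addColumn s v (baxter⇒TopRow b) v≤k)

-- The lower border and r

-- The lower border from height y through columns with the given bottoms, up to and including the
-- last horizontal step: the final vertical run along the last column is left out.
bottomPath : ℕ → List ℕ → List Step
bottomPath y []       = []
bottomPath y (b ∷ bs) = replicate (b ∸ y) N ++ E ∷ bottomPath b bs

lb≡bottomPath : ∀ y cs → lb y cs ≡ bottomPath y (map proj₁ cs) ++ replicate (lastHeight cs) N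
lb≡bottomPath y []                 = refl
lb≡bottomPath y ((b , t) ∷ [])     = sym (++-assoc (replicate (b ∸ y) N) (E ∷ []) (replicate (t ∸ b) N))
lb≡bottomPath y ((b , t) ∷ c ∷ cs) =
  trans (cong (λ ps → replicate (b ∸ y) N ++ E ∷ ps) (lb≡bottomPath b (c ∷ cs)))
        (sym (++-assoc (replicate (b ∸ y) N) (E ∷ bottomPath b (map proj₁ (c ∷ cs))) _))

prefixToAbscissa-replicateN : ∀ x d ps → prefixToAbscissa (suc x) (replicate d N ++ ps) ≡ replicate d N ++ prefixToAbscissa (suc x) ps
prefixToAbscissa-replicateN x zero    ps = refl
prefixToAbscissa-replicateN x (suc d) ps = cong (N ∷_) (prefixToAbscissa-replicateN x d ps)

prefixToAbscissa-bottomPath-++ : ∀ x y bs ps → x ≤ length bs →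
  prefixToAbscissa x (bottomPath y bs ++ ps) ≡ prefixToAbscissa x (bottomPath y bs)
prefixToAbscissa-bottomPath-++ zero    y bs       ps _         = refl
prefixToAbscissa-bottomPath-++ (suc x) y (b ∷ bs) ps (s≤s x≤n) = begin
  prefixToAbscissa (suc x) ((replicate (b ∸ y) N ++ E ∷ bottomPath b bs) ++ ps)
    ≡⟨ cong (prefixToAbscissa (suc x)) (++-assoc (replicate (b ∸ y) N) (E ∷ bottomPath b bs) ps) ⟩
  prefixToAbscissa (suc x) (replicate (b ∸ y) N ++ E ∷ (bottomPath b bs ++ ps))
    ≡⟨ prefixToAbscissa-replicateN x (b ∸ y) (E ∷ (bottomPath b bs ++ ps)) ⟩
  replicate (b ∸ y) N ++ E ∷ prefixToAbscissa x (bottomPath b bs ++ ps)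
    ≡⟨ cong (λ qs → replicate (b ∸ y) N ++ E ∷ qs) (prefixToAbscissa-bottomPath-++ x b bs ps x≤n) ⟩
  replicate (b ∸ y) N ++ E ∷ prefixToAbscissa x (bottomPath b bs)
    ≡⟨ prefixToAbscissa-replicateN x (b ∸ y) (E ∷ bottomPath b bs) ⟨
  prefixToAbscissa (suc x) (replicate (b ∸ y) N ++ E ∷ bottomPath b bs) ∎

prefixToAbscissa-bottomPath : ∀ y bs → prefixToAbscissa (length bs) (bottomPath y bs) ≡ bottomPath y bs
prefixToAbscissa-bottomPath y []       = refl
prefixToAbscissa-bottomPath y (b ∷ bs) =
  trans (prefixToAbscissa-replicateN (length bs) (b ∸ y) (E ∷ bottomPath b bs))
        (cong (λ ps → replicate (b ∸ y) N ++ E ∷ ps) (prefixToAbscissa-bottomPath b bs))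

bottoms : Slicing → List ℕ
bottoms s = map proj₁ (cols s)

-- r depends only on the bottoms of the columns.
rOfBottoms : List ℕ → ℕ → ℕ
rOfBottoms bs x = leadingE (reverse (prefixToAbscissa x (bottomPath 0 bs)))

rAt≡rOfBottoms : ∀ s x → x ≤ width s → rAt s x ≡ rOfBottoms (bottoms s) x
rAt≡rOfBottoms s x x≤w = cong (leadingE ∘ reverse)
  (trans (cong (prefixToAbscissa x) (lb≡bottomPath 0 (cols s)))
         (prefixToAbscissa-bottomPath-++ x 0 (bottoms s) _ (subst (x ≤_) (sym (length-map proj₁ (cols s))) x≤w)))

lastBottom : ℕ → List ℕ → ℕ
lastBottom y []       = y
lastBottom y (b ∷ bs) = lastBottom b bs

lastBottom≡ : ∀ y cs → 1 ≤ length cs → lastBottom y (map proj₁ cs) ≡ proj₁ (lastColumn cs)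
lastBottom≡ y (c ∷ [])     _ = refl
lastBottom≡ y (c ∷ d ∷ cs) _ = lastBottom≡ (proj₁ c) (d ∷ cs) (s≤s z≤n)

bottomPath-∷ʳ : ∀ y bs b → bottomPath y (bs ++ b ∷ []) ≡ bottomPath y bs ++ replicate (b ∸ lastBottom y bs) N ++ E ∷ []
bottomPath-∷ʳ y []        b = refl
bottomPath-∷ʳ y (b′ ∷ bs) b =
  trans (cong (λ ps → replicate (b′ ∸ y) N ++ E ∷ ps) (bottomPath-∷ʳ b′ bs b))
        (sym (++-assoc (replicate (b′ ∸ y) N) (E ∷ bottomPath b′ bs) _))

rOfBottoms-∷ʳ : ∀ bs b x → x ≤ length bs → rOfBottoms (bs ++ b ∷ []) x ≡ rOfBottoms bs x
rOfBottoms-∷ʳ bs b x x≤n = cong (leadingE ∘ reverse)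
  (trans (cong (prefixToAbscissa x) (bottomPath-∷ʳ 0 bs b)) (prefixToAbscissa-bottomPath-++ x 0 bs _ x≤n))

width-H : ∀ w s → width (H w s) ≡ width s
width-H w s = length-raiseLast w (cols s)

width-V : ∀ v s → width (V v s) ≡ suc (width s)
width-V v s = trans (length-++ (cols s)) (+-comm (width s) 1)

bottoms-H : ∀ w s → bottoms (H w s) ≡ bottoms s
bottoms-H w s = bottoms-raiseLast w (cols s)

bottoms-V : ∀ v s → bottoms (V v s) ≡ bottoms s ++ (height s ∸ v) ∷ []
bottoms-V v s = map-++ proj₁ (cols s) _

rAt-H : ∀ w s x → x ≤ width s → rAt (H w s) x ≡ rAt s x
rAt-H w s x x≤w = begin
  rAt (H w s) x                  ≡⟨ rAt≡rOfBottoms (H w s) x (subst (x ≤_) (sym (width-H w s)) x≤w) ⟩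
  rOfBottoms (bottoms (H w s)) x ≡⟨ cong (λ bs → rOfBottoms bs x) (bottoms-H w s) ⟩
  rOfBottoms (bottoms s) x       ≡⟨ rAt≡rOfBottoms s x x≤w ⟨
  rAt s x                        ∎

rAt-V : ∀ v s x → x ≤ width s → rAt (V v s) x ≡ rAt s x
rAt-V v s x x≤w = begin
  rAt (V v s) x                  ≡⟨ rAt≡rOfBottoms (V v s) x (subst (x ≤_) (sym (width-V v s)) (m≤n⇒m≤1+n x≤w)) ⟩
  rOfBottoms (bottoms (V v s)) x ≡⟨ cong (λ bs → rOfBottoms bs x) (bottoms-V v s) ⟩
  rOfBottoms (bottoms s ++ (height s ∸ v) ∷ []) x
    ≡⟨ rOfBottoms-∷ʳ (bottoms s) _ x (subst (x ≤_) (sym (length-map proj₁ (cols s))) x≤w) ⟩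
  rOfBottoms (bottoms s) x       ≡⟨ rAt≡rOfBottoms s x x≤w ⟨
  rAt s x                        ∎

rRight : Slicing → ℕ
rRight s = rAt s (width s)

rRight≡ : ∀ s → rRight s ≡ leadingE (reverse (bottomPath 0 (bottoms s)))
rRight≡ s = trans (rAt≡rOfBottoms s (width s) ≤-refl) (cong (leadingE ∘ reverse)
  (trans (cong (λ k → prefixToAbscissa k (bottomPath 0 (bottoms s))) (sym (length-map proj₁ (cols s))))
         (prefixToAbscissa-bottomPath 0 (bottoms s))))

rRight-H : ∀ w s → rRight (H w s) ≡ rRight s
rRight-H w s = trans (cong (rAt (H w s)) (width-H w s)) (rAt-H w s (width s) ≤-refl)

-- Reading leftwards from the bottom-right corner, a new column of height v first meets the
-- k - v vertical steps of the old last column (k its height), then the old horizontal run.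
rRight-V : ∀ s v → TopRow (cols s) (height s) →
  rRight (V v s) ≡ suc (leadingE (reverse (bottomPath 0 (bottoms s) ++ replicate (rightColHeight s ∸ v) N)))
rRight-V s v top = begin
  rRight (V v s)
    ≡⟨ rRight≡ (V v s) ⟩
  leadingE (reverse (bottomPath 0 (bottoms (V v s))))
    ≡⟨ cong (leadingE ∘ reverse ∘ bottomPath 0) (bottoms-V v s) ⟩
  leadingE (reverse (bottomPath 0 (bottoms s ++ (T ∸ v) ∷ [])))
    ≡⟨ cong (leadingE ∘ reverse) (bottomPath-∷ʳ 0 (bottoms s) (T ∸ v)) ⟩
  leadingE (reverse (P ++ replicate ((T ∸ v) ∸ lastBottom 0 (bottoms s)) N ++ E ∷ []))
    ≡⟨ cong (λ d → leadingE (reverse (P ++ replicate d N ++ E ∷ []))) drop≡ ⟩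
  leadingE (reverse (P ++ replicate (rightColHeight s ∸ v) N ++ E ∷ []))
    ≡⟨ cong (leadingE ∘ reverse) (sym (++-assoc P (replicate (rightColHeight s ∸ v) N) (E ∷ []))) ⟩
  leadingE (reverse ((P ++ replicate (rightColHeight s ∸ v) N) ++ E ∷ []))
    ≡⟨ cong leadingE (reverse-++ (P ++ replicate (rightColHeight s ∸ v) N) (E ∷ [])) ⟩
  suc (leadingE (reverse (P ++ replicate (rightColHeight s ∸ v) N))) ∎
  where
  T = height s
  P = bottomPath 0 (bottoms s)
  b = proj₁ (lastColumn (cols s))
  k≡ : rightColHeight s ≡ T ∸ b
  k≡ = trans (lastHeight≡ (cols s)) (cong (_∸ b) (trans (sym (lastTop≡ (cols s))) (TopRow⇒lastTop top)))
  drop≡ : (T ∸ v) ∸ lastBottom 0 (bottoms s) ≡ rightColHeight s ∸ v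
  drop≡ = begin
    (T ∸ v) ∸ lastBottom 0 (bottoms s) ≡⟨ cong ((T ∸ v) ∸_) (lastBottom≡ 0 (cols s) (TopRow⇒nonempty top)) ⟩
    (T ∸ v) ∸ b                        ≡⟨ ∸-+-assoc T v b ⟩
    T ∸ (v + b)                        ≡⟨ cong (T ∸_) (+-comm v b) ⟩
    T ∸ (b + v)                        ≡⟨ ∸-+-assoc T b v ⟨
    (T ∸ b) ∸ v                        ≡⟨ cong (_∸ v) k≡ ⟨
    rightColHeight s ∸ v               ∎

rRight-V-full : ∀ s → TopRow (cols s) (height s) → rRight (V (rightColHeight s) s) ≡ suc (rRight s)
rRight-V-full s top = begin
  rRight (V k s)
    ≡⟨ rRight-V s k top ⟩
  suc (leadingE (reverse (bottomPath 0 (bottoms s) ++ replicate (k ∸ k) N)))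
    ≡⟨ cong (λ d → suc (leadingE (reverse (bottomPath 0 (bottoms s) ++ replicate d N)))) (n∸n≡0 k) ⟩
  suc (leadingE (reverse (bottomPath 0 (bottoms s) ++ [])))
    ≡⟨ cong (λ ps → suc (leadingE (reverse ps))) (++-identityʳ (bottomPath 0 (bottoms s))) ⟩
  suc (leadingE (reverse (bottomPath 0 (bottoms s))))
    ≡⟨ cong suc (rRight≡ s) ⟨
  suc (rRight s) ∎
  where
  k = rightColHeight s

leadingE-reverse-N : ∀ ps d → leadingE (reverse (ps ++ replicate (suc d) N)) ≡ 0
leadingE-reverse-N ps d = cong leadingE (begin
  reverse (ps ++ replicate (suc d) N)      ≡⟨ cong (reverse ∘ (ps ++_)) (replicate-∷ʳ d) ⟩
  reverse (ps ++ replicate d N ++ N ∷ [])  ≡⟨ cong reverse (++-assoc ps (replicate d N) (N ∷ [])) ⟨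
  reverse ((ps ++ replicate d N) ++ N ∷ []) ≡⟨ reverse-++ (ps ++ replicate d N) (N ∷ []) ⟩
  N ∷ reverse (ps ++ replicate d N)        ∎)
  where
  replicate-∷ʳ : ∀ d → replicate (suc d) N ≡ replicate d N ++ N ∷ []
  replicate-∷ʳ zero    = refl
  replicate-∷ʳ (suc d) = cong (N ∷_) (replicate-∷ʳ d)

rRight-V< : ∀ s v → TopRow (cols s) (height s) → v < rightColHeight s → rRight (V v s) ≡ 1
rRight-V< s v top v<k with rightColHeight s ∸ v in eq
... | zero  = ⊥-elim (m>n⇒m∸n≢0 v<k eq)
... | suc d = begin
  rRight (V v s)                                                             ≡⟨ rRight-V s v top ⟩
  suc (leadingE (reverse (bottomPath 0 (bottoms s) ++ replicate (rightColHeight s ∸ v) N)))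
    ≡⟨ cong (λ d → suc (leadingE (reverse (bottomPath 0 (bottoms s) ++ replicate d N)))) eq ⟩
  suc (leadingE (reverse (bottomPath 0 (bottoms s) ++ replicate (suc d) N)))  ≡⟨ cong suc (leadingE-reverse-N (bottomPath 0 (bottoms s)) d) ⟩
  1                                                                          ∎

All-≤-suc-cong : ∀ {W} {f g : ℕ → ℕ} → (∀ x → x ≤ W → f x ≡ g x) → ∀ {us : List (ℕ × ℕ)} →
  All (λ u → proj₂ u ≤ W) us → All (λ u → proj₁ u ≤ suc (f (proj₂ u))) us → All (λ u → proj₁ u ≤ suc (g (proj₂ u))) us
All-≤-suc-cong f≡g []           []       = []
All-≤-suc-cong f≡g (x≤W ∷ x≤Ws) (p ∷ ps) = subst (λ r → _ ≤ suc r) (f≡g _ x≤W) p ∷ All-≤-suc-cong f≡g x≤Ws ps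

hblocks-≤width : ∀ s → All (λ u → proj₂ u ≤ width s) (hblocks s)
hblocks-≤width cell    = []
hblocks-≤width (H w s) = ≤-reflexive (sym (width-H w s)) ∷ All.map (subst (_ ≤_) (sym (width-H w s))) (hblocks-≤width s)
hblocks-≤width (V v s) = All.map (subst (_ ≤_) (sym (width-V v s)) ∘′ m≤n⇒m≤1+n) (hblocks-≤width s)

schroder-H⁻ : ∀ w s → Schroder (H w s) → Schroder s × 1 ≤ w × w ≤ topRowWidth s × w ≤ suc (rRight s)
schroder-H⁻ w s (hB b 1≤w w≤t , w≤r ∷ ok) =
  (b , All-≤-suc-cong (rAt-H w s) (hblocks-≤width s) ok) , 1≤w , w≤t , subst (λ r → w ≤ suc r) (rAt-H w s (width s) ≤-refl) w≤r

schroder-H⁺ : ∀ w s → Schroder s → 1 ≤ w → w ≤ topRowWidth s → w ≤ suc (rRight s) → Schroder (H w s)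
schroder-H⁺ w s (b , ok) 1≤w w≤t w≤r =
  hB b 1≤w w≤t , subst (λ r → w ≤ suc r) (sym (rAt-H w s (width s) ≤-refl)) w≤r
               ∷ All-≤-suc-cong (λ x x≤w → sym (rAt-H w s x x≤w)) (hblocks-≤width s) ok

schroder-V⁻ : ∀ v s → Schroder (V v s) → Schroder s × 1 ≤ v × v ≤ rightColHeight s
schroder-V⁻ v s (vB b 1≤v v≤k , ok) = (b , All-≤-suc-cong (rAt-V v s) (hblocks-≤width s) ok) , 1≤v , v≤k

schroder-V⁺ : ∀ v s → Schroder s → 1 ≤ v → v ≤ rightColHeight s → Schroder (V v s)
schroder-V⁺ v s (b , ok) 1≤v v≤k = vB b 1≤v v≤k , All-≤-suc-cong (λ x x≤w → sym (rAt-V v s x x≤w)) (hblocks-≤width s) ok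

maxRowWidth : Slicing → ℕ
maxRowWidth s = topRowWidth s ⊓ suc (rRight s)

1≤topRowWidth : ∀ s → TopRow (cols s) (height s) → 1 ≤ topRowWidth s
1≤topRowWidth s top = subst (1 ≤_) (sym (TopRow⇒topRowLength top)) (s≤s z≤n)

1≤rightColHeight : ∀ {s} → Baxter s → 1 ≤ rightColHeight s
1≤rightColHeight cellB                  = s≤s z≤n
1≤rightColHeight {H w s} (hB b 1≤w w≤t) =
  subst (1 ≤_) (sym (AddRow.rightColHeight≡ (addRow s w (baxter⇒TopRow b) 1≤w w≤t))) (s≤s z≤n)
1≤rightColHeight {V v s} (vB b 1≤v v≤k) =
  subst (1 ≤_) (sym (AddColumn.rightColHeight≡ (addColumn s v (baxter⇒TopRow b) v≤k))) 1≤v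

maxRowWidth-isMax : ∀ s → Schroder s → MaxHorizontal s (maxRowWidth s)
maxRowWidth-isMax s S@(b , _) =
  schroder-H⁺ (maxRowWidth s) s S (⊓-glb (1≤topRowWidth s (baxter⇒TopRow b)) (s≤s z≤n)) (m⊓n≤m _ _) (m⊓n≤n _ _) ,
  λ w Sw → let (_ , _ , w≤t , w≤r) = schroder-H⁻ w s Sw in ⊓-glb w≤t w≤r

label : ∀ s → Schroder s → Label s (maxRowWidth s) (rightColHeight s)
label s S = maxRowWidth-isMax s S , refl

MaxHorizontal-unique : ∀ {s h h′} → MaxHorizontal s h → MaxHorizontal s h′ → h ≡ h′
MaxHorizontal-unique (S , max) (S′ , max′) = ≤-antisym (max′ _ S) (max _ S′)

label-H : ∀ s w → Schroder s → 1 ≤ w → w ≤ maxRowWidth s →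
          Schroder (H w s) × Label (H w s) w (suc (rightColHeight s))
label-H s w S@(b , _) 1≤w w≤m =
  SH , subst (MaxHorizontal (H w s)) m≡w (maxRowWidth-isMax (H w s) SH) , sym (AddRow.rightColHeight≡ row)
  where
  w≤t = ≤-trans w≤m (m⊓n≤m _ _)
  w≤r = ≤-trans w≤m (m⊓n≤n _ _)
  SH  = schroder-H⁺ w s S 1≤w w≤t w≤r
  row = addRow s w (baxter⇒TopRow b) 1≤w w≤t
  m≡w : maxRowWidth (H w s) ≡ w
  m≡w = trans (cong₂ (λ t r → t ⊓ suc r) (AddRow.topRowWidth≡ row) (rRight-H w s)) (m≤n⇒m⊓n≡m w≤r)

label-V< : ∀ s v → Schroder s → 1 ≤ v → v < rightColHeight s → Schroder (V v s) × Label (V v s) 2 v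
label-V< s v S@(b , _) 1≤v v<k =
  SV , subst (MaxHorizontal (V v s)) m≡2 (maxRowWidth-isMax (V v s) SV) , sym (AddColumn.rightColHeight≡ col)
  where
  top = baxter⇒TopRow b
  SV  = schroder-V⁺ v s S 1≤v (<⇒≤ v<k)
  col = addColumn s v top (<⇒≤ v<k)
  m≡2 : maxRowWidth (V v s) ≡ 2
  m≡2 = begin
    topRowWidth (V v s) ⊓ suc (rRight (V v s)) ≡⟨ cong₂ (λ t r → t ⊓ suc r) (AddColumn.topRowWidth≡ col) (rRight-V< s v top v<k) ⟩
    suc (topRowWidth s) ⊓ 2                     ≡⟨ m≥n⇒m⊓n≡n (s≤s (1≤topRowWidth s top)) ⟩
    2                                           ∎

label-V-full : ∀ s → Schroder s → Schroder (V (rightColHeight s) s) × Label (V (rightColHeight s) s) (suc (maxRowWidth s)) (rightColHeight s)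
label-V-full s S@(b , _) =
  SV , subst (MaxHorizontal (V k s)) m≡ (maxRowWidth-isMax (V k s) SV) , sym (AddColumn.rightColHeight≡ col)
  where
  k   = rightColHeight s
  top = baxter⇒TopRow b
  SV  = schroder-V⁺ k s S (1≤rightColHeight b) ≤-refl
  col = addColumn s k top ≤-refl
  m≡ : maxRowWidth (V k s) ≡ suc (maxRowWidth s)
  m≡ = cong₂ (λ t r → t ⊓ suc r) (AddColumn.topRowWidth≡ col) (rRight-V-full s top)

-- The succession rule

rowChildren : Slicing → List Slicing
rowChildren s = map (λ i → H (suc i) s) (upTo (maxRowWidth s))

shortColumnChildren : Slicing → List Slicing
shortColumnChildren s = map (λ j → V (suc j) s) (upTo (rightColHeight s ∸ 1))

children : Slicing → List Slicing
children s = rowChildren s ++ shortColumnChildren s ++ V (rightColHeight s) s ∷ []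

<∸1⇒suc< : ∀ {j k} → j < k ∸ 1 → suc j < k
<∸1⇒suc< {k = suc k} j<k = s≤s j<k

suc<⇒<∸1 : ∀ {j k} → suc j < k → j < k ∸ 1
suc<⇒<∸1 {k = suc k} (s≤s j<k) = j<k

Pointwise-map-diagonal : ∀ {A B C : Set} {R : B → C → Set} (f : A → B) (g : A → C) {xs} →
  All (λ x → R (f x) (g x)) xs → Pointwise R (map f xs) (map g xs)
Pointwise-map-diagonal f g []       = []
Pointwise-map-diagonal f g (r ∷ rs) = r ∷ Pointwise-map-diagonal f g rs

children-labels : ∀ p → Schroder p →
  Pointwise (λ c hk → Schroder c × Label c (proj₁ hk) (proj₂ hk)) (children p) (newSch (maxRowWidth p) (rightColHeight p))
children-labels p S = Pointwise.++⁺ rows (Pointwise.++⁺ columns (label-V-full p S ∷ []))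
  where
  rows = Pointwise-map-diagonal _ _ (All.tabulate λ i∈ → label-H p (suc _) S (s≤s z≤n) (∈-upTo⁻ i∈))
  columns = Pointwise-map-diagonal _ _ (All.tabulate λ j∈ → label-V< p (suc _) S (s≤s z≤n) (<∸1⇒suc< (∈-upTo⁻ j∈)))

children-sound : ∀ p c → Schroder p → c ∈ children p → Schroder c × GrowsFrom p c
children-sound p c S c∈ with ∈-++⁻ (rowChildren p) c∈
... | inj₁ c∈rows with ∈-map⁻ _ c∈rows
...   | i , i∈ , refl = proj₁ (label-H p (suc i) S (s≤s z≤n) (∈-upTo⁻ i∈)) , inj₁ (suc i , refl)
children-sound p c S c∈ | inj₂ c∈ʳ with ∈-++⁻ (shortColumnChildren p) c∈ʳ
... | inj₁ c∈columns with ∈-map⁻ _ c∈columns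
...   | j , j∈ , refl = proj₁ (label-V< p (suc j) S (s≤s z≤n) (<∸1⇒suc< (∈-upTo⁻ j∈))) , inj₂ (suc j , refl)
children-sound p c S c∈ | inj₂ c∈ʳ | inj₂ (here refl) = proj₁ (label-V-full p S) , inj₂ (rightColHeight p , refl)

children-complete : ∀ p c → Schroder c → GrowsFrom p c → c ∈ children p
children-complete p c Sc (inj₁ (w , refl)) with schroder-H⁻ w p Sc
... | _ , s≤s _ , w≤t , w≤r = ∈-++⁺ˡ (∈-map⁺ _ (∈-upTo⁺ (⊓-glb w≤t w≤r)))
children-complete p c Sc (inj₂ (v , refl)) with schroder-V⁻ v p Sc
... | _ , s≤s _ , v≤k with m≤n⇒m<n∨m≡n v≤k
...   | inj₁ v<k = ∈-++⁺ʳ (rowChildren p) (∈-++⁺ˡ (∈-map⁺ _ (∈-upTo⁺ (suc<⇒<∸1 v<k))))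
...   | inj₂ v≡k = ∈-++⁺ʳ (rowChildren p) (∈-++⁺ʳ (shortColumnChildren p) (here (cong (λ v → V v p) v≡k)))

∈-children⇔ : ∀ p → Schroder p → ∀ c → (c ∈ children p) ⇔ (Schroder c × GrowsFrom p c)
∈-children⇔ p S c = mk⇔ (children-sound p c S) (λ (Sc , g) → children-complete p c Sc g)

children-unique : ∀ p → Unique (children p)
children-unique p =
  Unique.++⁺ (Unique.map⁺ (suc-injective ∘ H-injective) (Unique.upTo⁺ (maxRowWidth p)))
             (Unique.++⁺ (Unique.map⁺ (suc-injective ∘ V-injective) (Unique.upTo⁺ (rightColHeight p ∸ 1))) ([] ∷ []) columns∩full)
             rows∩columns
  where
  H-injective : ∀ {a b} → H a p ≡ H b p → a ≡ b
  H-injective refl = refl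
  V-injective : ∀ {a b} → V a p ≡ V b p → a ≡ b
  V-injective refl = refl
  columns∩full : ∀ {c} → c ∈ shortColumnChildren p × c ∈ V (rightColHeight p) p ∷ [] → ⊥
  columns∩full (c∈ , here eq) with ∈-map⁻ _ c∈
  ... | j , j∈ , refl = <⇒≢ (<∸1⇒suc< (∈-upTo⁻ j∈)) (V-injective eq)
  rows∩columns : ∀ {c} → c ∈ rowChildren p ×
                         c ∈ shortColumnChildren p ++ V (rightColHeight p) p ∷ [] → ⊥
  rows∩columns (c∈ , c∈′) with ∈-map⁻ _ c∈
  ... | i , _ , refl with ∈-++⁻ (shortColumnChildren p) c∈′
  ...   | inj₁ c∈columns with ∈-map⁻ _ c∈columns
  ...     | _ , _ , ()
  rows∩columns (c∈ , c∈′) | i , _ , refl | inj₂ (here ())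

parent : Slicing → Slicing
parent cell    = cell
parent (H _ s) = s
parent (V _ s) = s

parent-children : ∀ p → All (λ c → parent c ≡ p) (children p)
parent-children p = All.++⁺ (All.map⁺ (All.universal (λ _ → refl) (upTo (maxRowWidth p))))
                   (All.++⁺ (All.map⁺ (All.universal (λ _ → refl) (upTo (rightColHeight p ∸ 1)))) (refl ∷ []))

-- Formal power series over ℕ, as coefficient sequences

Series : Set
Series = ℕ → ℕ

sumUpTo : Series → ℕ → ℕ
sumUpTo f zero    = 0
sumUpTo f (suc n) = f 0 + sumUpTo (f ∘ suc) n

sumUpTo-cong : ∀ n {f g : Series} → (∀ i → i < n → f i ≡ g i) → sumUpTo f n ≡ sumUpTo g n
sumUpTo-cong zero    f≡g = refl
sumUpTo-cong (suc n) f≡g = cong₂ _+_ (f≡g 0 z<s) (sumUpTo-cong n (λ i i<n → f≡g (suc i) (s<s i<n)))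

sumUpTo-suc : ∀ n (f : Series) → sumUpTo f (suc n) ≡ sumUpTo f n + f n
sumUpTo-suc zero    f = +-comm (f 0) 0
sumUpTo-suc (suc n) f = trans (cong (f 0 +_) (sumUpTo-suc n (f ∘ suc))) (sym (+-assoc (f 0) _ _))

sumUpTo-+ : ∀ n (f g : Series) → sumUpTo (λ i → f i + g i) n ≡ sumUpTo f n + sumUpTo g n
sumUpTo-+ zero    f g = refl
sumUpTo-+ (suc n) f g = begin
  f 0 + g 0 + sumUpTo (λ i → f (suc i) + g (suc i)) n
    ≡⟨ cong (f 0 + g 0 +_) (sumUpTo-+ n (f ∘ suc) (g ∘ suc)) ⟩
  f 0 + g 0 + (sumUpTo (f ∘ suc) n + sumUpTo (g ∘ suc) n)
    ≡⟨ +-assoc-comm (f 0) (g 0) _ _ ⟩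
  f 0 + sumUpTo (f ∘ suc) n + (g 0 + sumUpTo (g ∘ suc) n) ∎
  where
  +-assoc-comm : ∀ a b c d → a + b + (c + d) ≡ a + c + (b + d)
  +-assoc-comm = solve-∀

sumUpTo-*ˡ : ∀ n c (f : Series) → sumUpTo (λ i → c * f i) n ≡ c * sumUpTo f n
sumUpTo-*ˡ zero    c f = sym (*-zeroʳ c)
sumUpTo-*ˡ (suc n) c f = trans (cong (c * f 0 +_) (sumUpTo-*ˡ n c (f ∘ suc))) (sym (*-distribˡ-+ c (f 0) _))

sumUpTo-0 : ∀ n → sumUpTo (λ _ → 0) n ≡ 0
sumUpTo-0 zero    = refl
sumUpTo-0 (suc n) = sumUpTo-0 n

sumUpTo-+-split : ∀ m n (f : Series) → sumUpTo f (m + n) ≡ sumUpTo f m + sumUpTo (λ i → f (m + i)) n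
sumUpTo-+-split zero    n f = refl
sumUpTo-+-split (suc m) n f = trans (cong (f 0 +_) (sumUpTo-+-split m n (f ∘ suc))) (sym (+-assoc (f 0) _ _))

sumUpTo-reverse : ∀ n (f : Series) → sumUpTo f n ≡ sumUpTo (λ i → f (n ∸ suc i)) n
sumUpTo-reverse zero    f = refl
sumUpTo-reverse (suc n) f = begin
  f 0 + sumUpTo (f ∘ suc) n
    ≡⟨ cong (f 0 +_) (sumUpTo-reverse n (f ∘ suc)) ⟩
  f 0 + sumUpTo (λ i → f (suc (n ∸ suc i))) n
    ≡⟨ cong (f 0 +_) (sumUpTo-cong n (λ i i<n → cong f (sym (+-∸-assoc 1 i<n)))) ⟩
  f 0 + sumUpTo (λ i → f (n ∸ i)) n
    ≡⟨ +-comm (f 0) _ ⟩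
  sumUpTo (λ i → f (n ∸ i)) n + f 0
    ≡⟨ cong (λ m → sumUpTo (λ i → f (n ∸ i)) n + f m) (sym (n∸n≡0 n)) ⟩
  sumUpTo (λ i → f (n ∸ i)) n + f (n ∸ n)
    ≡⟨ sym (sumUpTo-suc n (λ i → f (n ∸ i))) ⟩
  sumUpTo (λ i → f (n ∸ i)) (suc n) ∎

_⊕_ : Series → Series → Series
(f ⊕ g) n = f n + g n

_•_ : ℕ → Series → Series
(c • f) n = c * f n

_⋆_ : Series → Series → Series
(f ⋆ g) n = sumUpTo (λ i → f i * g (n ∸ i)) (suc n)

unit : Series
unit zero    = 1
unit (suc n) = 0

shift : Series → Series
shift f zero    = 0
shift f (suc n) = f n

infixl 6 _⊕_
infixl 7 _⋆_
infixr 8 _•_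

⋆-congˡ : ∀ n f {g g′ : Series} → (∀ i → i ≤ n → g i ≡ g′ i) → (f ⋆ g) n ≡ (f ⋆ g′) n
⋆-congˡ n f g≡g′ = sumUpTo-cong (suc n) λ i _ → cong (f i *_) (g≡g′ (n ∸ i) (m∸n≤m n i))

⋆-congʳ : ∀ n g {f f′ : Series} → (∀ i → i ≤ n → f i ≡ f′ i) → (f ⋆ g) n ≡ (f′ ⋆ g) n
⋆-congʳ n g f≡f′ = sumUpTo-cong (suc n) λ i i≤n → cong (_* g (n ∸ i)) (f≡f′ i (≤-pred i≤n))

⋆-distribʳ-⊕ : ∀ n f g h → ((f ⊕ g) ⋆ h) n ≡ (f ⋆ h) n + (g ⋆ h) n
⋆-distribʳ-⊕ n f g h = trans (sumUpTo-cong (suc n) (λ i _ → *-distribʳ-+ (h (n ∸ i)) (f i) (g i)))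
                             (sumUpTo-+ (suc n) (λ i → f i * h (n ∸ i)) (λ i → g i * h (n ∸ i)))

⋆-distribˡ-⊕ : ∀ n f g h → (f ⋆ (g ⊕ h)) n ≡ (f ⋆ g) n + (f ⋆ h) n
⋆-distribˡ-⊕ n f g h = trans (sumUpTo-cong (suc n) (λ i _ → *-distribˡ-+ (f i) (g (n ∸ i)) (h (n ∸ i))))
                             (sumUpTo-+ (suc n) (λ i → f i * g (n ∸ i)) (λ i → f i * h (n ∸ i)))

•-⋆-assoc : ∀ n c f g → (c • f ⋆ g) n ≡ c * (f ⋆ g) n
•-⋆-assoc n c f g = trans (sumUpTo-cong (suc n) (λ i _ → *-assoc c (f i) (g (n ∸ i))))
                          (sumUpTo-*ˡ (suc n) c (λ i → f i * g (n ∸ i)))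

⋆-•-comm : ∀ n c f g → (f ⋆ c • g) n ≡ c * (f ⋆ g) n
⋆-•-comm n c f g = trans (sumUpTo-cong (suc n) (λ i _ → *-left-comm (f i) c (g (n ∸ i))))
                         (sumUpTo-*ˡ (suc n) c (λ i → f i * g (n ∸ i)))
  where
  *-left-comm : ∀ a b c → a * (b * c) ≡ b * (a * c)
  *-left-comm = solve-∀

⋆-identityˡ : ∀ n g → (unit ⋆ g) n ≡ g n
⋆-identityˡ n g = trans (cong (g n + 0 +_) (sumUpTo-0 n)) (trans (+-identityʳ _) (+-identityʳ _))

⋆-comm : ∀ n f g → (f ⋆ g) n ≡ (g ⋆ f) n
⋆-comm n f g = trans (sumUpTo-reverse (suc n) (λ i → f i * g (n ∸ i))) (sumUpTo-cong (suc n) λ i i≤n →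
  trans (*-comm (f (n ∸ i)) (g (n ∸ (n ∸ i)))) (cong (λ m → g m * f (n ∸ i)) (m∸[m∸n]≡n (≤-pred i≤n))))

⋆-assoc : ∀ n f g h → ((f ⋆ g) ⋆ h) n ≡ (f ⋆ (g ⋆ h)) n
⋆-assoc zero    f g h = *-assoc′ (f 0) (g 0) (h 0)
  where
  *-assoc′ : ∀ a b c → (a * b + 0) * c + 0 ≡ a * (b * c + 0) + 0
  *-assoc′ = solve-∀
⋆-assoc (suc n) f g h = begin
  (f ⋆ g) 0 * h (suc n) + ((f ⋆ g) ∘ suc ⋆ h) n
    ≡⟨ cong ((f ⋆ g) 0 * h (suc n) +_) (⋆-distribʳ-⊕ n (f 0 • g ∘ suc) (f ∘ suc ⋆ g) h) ⟩
  (f ⋆ g) 0 * h (suc n) + ((f 0 • g ∘ suc ⋆ h) n + ((f ∘ suc ⋆ g) ⋆ h) n)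
    ≡⟨ cong₂ (λ a b → (f ⋆ g) 0 * h (suc n) + (a + b)) (•-⋆-assoc n (f 0) (g ∘ suc) h) (⋆-assoc n (f ∘ suc) g h) ⟩
  (f 0 * g 0 + 0) * h (suc n) + (f 0 * (g ∘ suc ⋆ h) n + (f ∘ suc ⋆ (g ⋆ h)) n)
    ≡⟨ regroup (f 0) (g 0) (h (suc n)) ((g ∘ suc ⋆ h) n) ((f ∘ suc ⋆ (g ⋆ h)) n) ⟩
  f 0 * (g 0 * h (suc n) + (g ∘ suc ⋆ h) n) + (f ∘ suc ⋆ (g ⋆ h)) n ∎
  where
  regroup : ∀ a b c d k → (a * b + 0) * c + (a * d + k) ≡ a * (b * c + d) + k
  regroup = solve-∀

-- Counting the generating tree

-- F j n counts the depth-n descendants of a node labelled j in the generating tree of the rule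
-- j ⇝ 1, 2, …, j + 1, j + 1.
F : ℕ → Series
F j zero    = 1
F j (suc n) = sumUpTo (λ i → F (suc i) n) (suc j) + F (suc j) n

GeometricAt : ℕ → ℕ → Set
GeometricAt n j = F (2 + j) n ≡ F (1 + j) n + (shift (F 1) ⋆ F (1 + j)) n

F₁-quadratic : ∀ n → (∀ m → m ≤ n → ∀ j → GeometricAt m j) →
               ∀ i → i ≤ suc n → F 1 i ≡ (unit ⊕ 3 • shift (F 1) ⊕ 2 • (shift (F 1) ⋆ shift (F 1))) i
F₁-quadratic n geo zero    _         = refl
F₁-quadratic n geo (suc m) (s≤s m≤n) = begin
  F 1 m + (F 2 m + 0) + F 2 m
    ≡⟨ cong (λ z → F 1 m + (z + 0) + z) (geo m m≤n 0) ⟩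
  F 1 m + ((F 1 m + (shift (F 1) ⋆ F 1) m) + 0) + (F 1 m + (shift (F 1) ⋆ F 1) m)
    ≡⟨ regroup (F 1 m) ((shift (F 1) ⋆ F 1) m) ⟩
  3 * F 1 m + 2 * (shift (F 1) ⋆ F 1) m
    ≡⟨ cong (λ z → 3 * F 1 m + 2 * z) (⋆-comm m (shift (F 1)) (F 1)) ⟩
  3 * F 1 m + 2 * (F 1 ⋆ shift (F 1)) m ∎
  where
  regroup : ∀ v c → v + ((v + c) + 0) + (v + c) ≡ 3 * v + 2 * c
  regroup = solve-∀

geometric-step : ∀ n → (∀ m → m ≤ n → ∀ j → GeometricAt m j) → ∀ j → GeometricAt (suc n) j
geometric-step n geo j = begin
  sumUpTo G (3 + j) + G (2 + j)
    ≡⟨ cong (_+ G (2 + j)) (sumUpTo-suc (2 + j) G) ⟩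
  sumUpTo G (2 + j) + G (2 + j) + G (2 + j)
    ≡⟨ cong (λ z → sumUpTo G (2 + j) + z + z) G₂ ⟩
  sumUpTo G (2 + j) + (b + p + (p + q)) + (b + p + (p + q))
    ≡⟨ regroup (sumUpTo G (2 + j)) b p q ⟩
  sumUpTo G (2 + j) + (b + p) + (b + (3 * p + 2 * q))
    ≡⟨ cong₂ (λ x y → sumUpTo G (2 + j) + x + y) (sym G₁) (sym F₁⋆B) ⟩
  sumUpTo G (2 + j) + G (1 + j) + (F 1 ⋆ B) n ∎
  where
  G B : Series
  G i = F (suc i) n
  B m = F (1 + j) m
  b p q : ℕ
  b = B n
  p = (shift (F 1) ⋆ B) n
  q = (shift (F 1) ⋆ (shift (F 1) ⋆ B)) n
  G₁ : G (1 + j) ≡ b + p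
  G₁ = geo n ≤-refl j
  G₂ : G (2 + j) ≡ b + p + (p + q)
  G₂ = begin
    F (3 + j) n                                            ≡⟨ geo n ≤-refl (suc j) ⟩
    F (2 + j) n + (shift (F 1) ⋆ F (2 + j)) n              ≡⟨ cong₂ _+_ G₁ (⋆-congˡ n (shift (F 1)) (λ i i≤n → geo i i≤n j)) ⟩
    b + p + (shift (F 1) ⋆ (B ⊕ shift (F 1) ⋆ B)) n        ≡⟨ cong (b + p +_) (⋆-distribˡ-⊕ n (shift (F 1)) B (shift (F 1) ⋆ B)) ⟩
    b + p + (p + q)                                        ∎
  F₁⋆B : (F 1 ⋆ B) n ≡ b + (3 * p + 2 * q)
  F₁⋆B = begin
    (F 1 ⋆ B) n
      ≡⟨ ⋆-congʳ n B (λ i i≤n → F₁-quadratic n geo i (m≤n⇒m≤1+n i≤n)) ⟩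
    ((unit ⊕ 3 • shift (F 1) ⊕ 2 • (shift (F 1) ⋆ shift (F 1))) ⋆ B) n
      ≡⟨ ⋆-distribʳ-⊕ n (unit ⊕ 3 • shift (F 1)) (2 • (shift (F 1) ⋆ shift (F 1))) B ⟩
    ((unit ⊕ 3 • shift (F 1)) ⋆ B) n + (2 • (shift (F 1) ⋆ shift (F 1)) ⋆ B) n
      ≡⟨ cong₂ _+_ (⋆-distribʳ-⊕ n unit (3 • shift (F 1)) B) (•-⋆-assoc n 2 (shift (F 1) ⋆ shift (F 1)) B) ⟩
    (unit ⋆ B) n + (3 • shift (F 1) ⋆ B) n + 2 * ((shift (F 1) ⋆ shift (F 1)) ⋆ B) n
      ≡⟨ cong₂ (λ x y → x + y + 2 * ((shift (F 1) ⋆ shift (F 1)) ⋆ B) n) (⋆-identityˡ n B) (•-⋆-assoc n 3 (shift (F 1)) B) ⟩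
    b + 3 * p + 2 * ((shift (F 1) ⋆ shift (F 1)) ⋆ B) n
      ≡⟨ cong (λ z → b + 3 * p + 2 * z) (⋆-assoc n (shift (F 1)) (shift (F 1)) B) ⟩
    b + 3 * p + 2 * q
      ≡⟨ +-assoc b _ _ ⟩
    b + (3 * p + 2 * q) ∎
  regroup : ∀ s b p q → s + (b + p + (p + q)) + (b + p + (p + q)) ≡ s + (b + p) + (b + (3 * p + 2 * q))
  regroup = solve-∀

geometric : ∀ n j → GeometricAt n j
geometric n = below n n ≤-refl
  where
  below : ∀ n m → m ≤ n → ∀ j → GeometricAt m j
  below zero    .zero z≤n j = refl
  below (suc n) m m≤1+n with m≤n⇒m<n∨m≡n m≤1+n
  ... | inj₁ m<1+n = below n m (≤-pred m<1+n)
  ... | inj₂ refl  = geometric-step n (below n)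

F₀-recurrence : ∀ n → F 0 (suc n) ≡ F 0 n + (F 0 ⋆ F 0) n
F₀-recurrence zero    = refl
F₀-recurrence (suc m) = begin
  F 1 (suc m) + 0 + F 1 (suc m)
    ≡⟨ cong (λ z → z + 0 + z) (F₁-quadratic m (λ i _ → geometric i) (suc m) ≤-refl) ⟩
  (3 * F 1 m + 2 * (F 1 ⋆ shift (F 1)) m) + 0 + (3 * F 1 m + 2 * (F 1 ⋆ shift (F 1)) m)
    ≡⟨ regroup (F 1 m) ((F 1 ⋆ shift (F 1)) m) ⟩
  F 0 (suc m) + (1 * F 0 (suc m) + 2 * (F 1 m + 2 * (F 1 ⋆ shift (F 1)) m))
    ≡⟨ cong (λ z → F 0 (suc m) + (1 * F 0 (suc m) + 2 * z)) (sym F₁⋆F₀) ⟩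
  F 0 (suc m) + (1 * F 0 (suc m) + 2 * (F 1 ⋆ F 0) m)
    ≡⟨ cong (λ z → F 0 (suc m) + (1 * F 0 (suc m) + z)) (sym (•-⋆-assoc m 2 (F 1) (F 0))) ⟩
  F 0 (suc m) + (1 * F 0 (suc m) + (2 • F 1 ⋆ F 0) m)
    ≡⟨ cong (λ z → F 0 (suc m) + (1 * F 0 (suc m) + z)) (⋆-congʳ m (F 0) (λ i _ → sym (F₀≡2F₁ i))) ⟩
  F 0 (suc m) + (F 0 ⋆ F 0) (suc m) ∎
  where
  regroup : ∀ v c → (3 * v + 2 * c) + 0 + (3 * v + 2 * c) ≡ (v + 0 + v) + (1 * (v + 0 + v) + 2 * (v + 2 * c))
  regroup = solve-∀
  F₀≡2F₁ : ∀ i → F 0 (suc i) ≡ 2 * F 1 i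
  F₀≡2F₁ i = twice (F 1 i)
    where
    twice : ∀ v → v + 0 + v ≡ 2 * v
    twice = solve-∀
  F₀≡1+2xF₁ : ∀ i → F 0 i ≡ (unit ⊕ 2 • shift (F 1)) i
  F₀≡1+2xF₁ zero    = refl
  F₀≡1+2xF₁ (suc i) = F₀≡2F₁ i
  F₁⋆F₀ : (F 1 ⋆ F 0) m ≡ F 1 m + 2 * (F 1 ⋆ shift (F 1)) m
  F₁⋆F₀ = begin
    (F 1 ⋆ F 0) m                                         ≡⟨ ⋆-congˡ m (F 1) (λ i _ → F₀≡1+2xF₁ i) ⟩
    (F 1 ⋆ (unit ⊕ 2 • shift (F 1))) m                    ≡⟨ ⋆-distribˡ-⊕ m (F 1) unit (2 • shift (F 1)) ⟩
    (F 1 ⋆ unit) m + (F 1 ⋆ 2 • shift (F 1)) m           ≡⟨ cong₂ _+_ (trans (⋆-comm m (F 1) unit) (⋆-identityˡ m (F 1))) (⋆-•-comm m 2 (F 1) (shift (F 1))) ⟩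
    F 1 m + 2 * (F 1 ⋆ shift (F 1)) m                     ∎

applyDownFrom≡applyUpTo : ∀ (f : ℕ → ℕ) n → applyDownFrom f n ≡ applyUpTo (λ i → f (n ∸ suc i)) n
applyDownFrom≡applyUpTo f zero    = refl
applyDownFrom≡applyUpTo f (suc n) = cong (f n ∷_) (applyDownFrom≡applyUpTo f n)

zipWith-applyUpTo : ∀ (f g : ℕ → ℕ) n → zipWith _*_ (applyUpTo f n) (applyUpTo g n) ≡ applyUpTo (λ i → f i * g i) n
zipWith-applyUpTo f g zero    = refl
zipWith-applyUpTo f g (suc n) = cong (f 0 * g 0 ∷_) (zipWith-applyUpTo (f ∘ suc) (g ∘ suc) n)

sum-applyUpTo : ∀ (f : ℕ → ℕ) n → sum (applyUpTo f n) ≡ sumUpTo f n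
sum-applyUpTo f zero    = refl
sum-applyUpTo f (suc n) = cong (f 0 +_) (sum-applyUpTo (f ∘ suc) n)

sum-zipWith-reverse : ∀ (f : Series) n →
  sum (zipWith _*_ (applyDownFrom f (suc n)) (reverse (applyDownFrom f (suc n)))) ≡ (f ⋆ f) n
sum-zipWith-reverse f n = begin
  sum (zipWith _*_ (applyDownFrom f (suc n)) (reverse (applyDownFrom f (suc n))))
    ≡⟨ cong₂ (λ xs ys → sum (zipWith _*_ xs ys)) (applyDownFrom≡applyUpTo f (suc n)) (reverse-applyDownFrom f (suc n)) ⟩
  sum (zipWith _*_ (applyUpTo (λ i → f (n ∸ i)) (suc n)) (applyUpTo f (suc n)))
    ≡⟨ cong sum (zipWith-applyUpTo (λ i → f (n ∸ i)) f (suc n)) ⟩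
  sum (applyUpTo (λ i → f (n ∸ i) * f i) (suc n))
    ≡⟨ sum-applyUpTo (λ i → f (n ∸ i) * f i) (suc n) ⟩
  sumUpTo (λ i → f (n ∸ i) * f i) (suc n)
    ≡⟨ sumUpTo-cong (suc n) (λ i _ → *-comm (f (n ∸ i)) (f i)) ⟩
  (f ⋆ f) n ∎

schroderUpTo≡applyDownFrom : ∀ n → schroderUpTo n ≡ applyDownFrom (F 0) (suc n)
schroderUpTo≡applyDownFrom zero    = refl
schroderUpTo≡applyDownFrom (suc n) rewrite schroderUpTo≡applyDownFrom n =
  cong (_∷ applyDownFrom (F 0) (suc n))
       (trans (cong (F 0 n +_) (sum-zipWith-reverse (F 0) n)) (sym (F₀-recurrence n)))

LargeSchroder≡F₀ : ∀ n → LargeSchroder (suc n) ≡ F 0 n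
LargeSchroder≡F₀ n rewrite schroderUpTo≡applyDownFrom n = refl

size-H : ∀ w s → Baxter s → 1 ≤ w → w ≤ topRowWidth s → size (H w s) ≡ suc (size s)
size-H w s b 1≤w w≤t =
  trans (cong₂ (λ x y → x + y ∸ 1) (width-H w s) (AddRow.height≡ (addRow s w top 1≤w w≤t)))
        (shift-size (width s) (height s) (TopRow⇒nonempty top))
  where
  top = baxter⇒TopRow b
  shift-size : ∀ x y → 1 ≤ x → x + suc y ∸ 1 ≡ suc (x + y ∸ 1)
  shift-size (suc x) y _ = +-suc x y

size-V : ∀ v s → Baxter s → v ≤ rightColHeight s → size (V v s) ≡ suc (size s)
size-V v s b v≤k =
  trans (cong₂ (λ x y → x + y ∸ 1) (width-V v s) (AddColumn.height≡ (addColumn s v top v≤k)))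
        (shift-size (width s) (height s) (TopRow⇒nonempty top))
  where
  top = baxter⇒TopRow b
  shift-size : ∀ x y → 1 ≤ x → suc x + y ∸ 1 ≡ suc (x + y ∸ 1)
  shift-size (suc x) y _ = refl

1≤size : ∀ {s} → Baxter s → 1 ≤ size s
1≤size cellB                    = s≤s z≤n
1≤size {H w s} (hB b 1≤w w≤t) = subst (1 ≤_) (sym (size-H w s b 1≤w w≤t)) (s≤s z≤n)
1≤size {V v s} (vB b 1≤v v≤k) = subst (1 ≤_) (sym (size-V v s b v≤k)) (s≤s z≤n)

size-GrowsFrom : ∀ p c → Schroder c → GrowsFrom p c → size c ≡ suc (size p)
size-GrowsFrom p c Sc (inj₁ (w , refl)) = let ((b , _) , 1≤w , w≤t , _) = schroder-H⁻ w p Sc in size-H w p b 1≤w w≤t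
size-GrowsFrom p c Sc (inj₂ (v , refl)) = let ((b , _) , _ , v≤k)     = schroder-V⁻ v p Sc in size-V v p b v≤k

-- the Schröder slicings of size n + 1
level : ℕ → List Slicing
level zero    = cell ∷ []
level (suc n) = concatMap children (level n)

level-sound : ∀ n s → s ∈ level n → Schroder s × size s ≡ suc n
level-sound zero    .cell (here refl) = (cellB , []) , refl
level-sound (suc n) s     s∈ with find (∈-concatMap⁻ children s∈)
... | p , p∈ , s∈p with level-sound n p p∈
...   | Sp , size≡ with children-sound p s Sp s∈p
...     | Ss , grows = Ss , trans (size-GrowsFrom p s Ss grows) (cong suc size≡)

GrowsFrom-schroder : ∀ p c → Schroder c → GrowsFrom p c → Schroder p
GrowsFrom-schroder p c S (inj₁ (w , refl)) = proj₁ (schroder-H⁻ w p S)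
GrowsFrom-schroder p c S (inj₂ (v , refl)) = proj₁ (schroder-V⁻ v p S)

mutual
  level-complete : ∀ n s → Schroder s → size s ≡ suc n → s ∈ level n
  level-complete zero    cell    _ _     = here refl
  level-complete (suc n) cell    _ ()
  level-complete n       (H w p) S size≡ = child∈level n p (H w p) S (inj₁ (w , refl)) size≡
  level-complete n       (V v p) S size≡ = child∈level n p (V v p) S (inj₂ (v , refl)) size≡

  child∈level : ∀ n p c → Schroder c → GrowsFrom p c → size c ≡ suc n → c ∈ level n
  child∈level n p c Sc grows size≡ with GrowsFrom-schroder p c Sc grows
                                      | suc-injective (trans (sym (size-GrowsFrom p c Sc grows)) size≡)
  child∈level zero    p c Sc grows size≡ | (b , _) | sizeP≡0 = ⊥-elim (<⇒≢ (1≤size b) (sym sizeP≡0))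
  child∈level (suc n) p c Sc grows size≡ | Sp      | sizeP≡ =
    ∈-concatMap⁺ children (lose (level-complete n p Sp sizeP≡) (children-complete p c Sc grows))

∈-level⇔ : ∀ n s → (s ∈ level n) ⇔ (Schroder s × size s ≡ suc n)
∈-level⇔ n s = mk⇔ (level-sound n s) (λ (S , size≡) → level-complete n s S size≡)

concatMap-children-unique : ∀ ps → Unique ps → Unique (concatMap children ps)
concatMap-children-unique []       []         = []
concatMap-children-unique (p ∷ ps) (p∉ ∷ ps!) =
  Unique.++⁺ (children-unique p) (concatMap-children-unique ps ps!) disjoint
  where
  disjoint : ∀ {c} → c ∈ children p × c ∈ concatMap children ps → ⊥
  disjoint (c∈p , c∈ps) with find (∈-concatMap⁻ children c∈ps)
  ... | q , q∈ps , c∈q = All.lookup p∉ q∈ps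
    (trans (sym (All.lookup (parent-children p) c∈p)) (All.lookup (parent-children q) c∈q))

level-unique : ∀ n → Unique (level n)
level-unique zero    = [] ∷ []
level-unique (suc n) = concatMap-children-unique (level n) (level-unique n)

labelOf : Slicing → ℕ × ℕ
labelOf s = maxRowWidth s , rightColHeight s

Label⇒labelOf : ∀ {c h k} → Schroder c → Label c h k → labelOf c ≡ (h , k)
Label⇒labelOf Sc (max , k≡) = cong₂ _,_ (MaxHorizontal-unique (maxRowWidth-isMax _ Sc) max) (sym k≡)

-- The label (h , k) collapses to the label j = (h - 1) + (k - 1) of the one-parameter rule counted by F.
collapse : ℕ × ℕ → ℕ
collapse (h , k) = pred h + pred k

sum-map-upTo : ∀ (f : ℕ → ℕ) n → sum (map f (upTo n)) ≡ sumUpTo f n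
sum-map-upTo f n = trans (cong sum (map-upTo f n)) (sum-applyUpTo f n)

sum-newSch : ∀ {h k} m → 1 ≤ h → 1 ≤ k →
  sum (map (λ hk → F (collapse hk) m) (newSch h k)) ≡ F (collapse (h , k)) (suc m)
sum-newSch {suc h} {suc k} m _ _ = begin
  sum (map G (rows ++ columns ++ (suc (suc h) , suc k) ∷ []))
    ≡⟨ cong sum (map-++ G rows (columns ++ _)) ⟩
  sum (map G rows ++ map G (columns ++ _))
    ≡⟨ sum-++ (map G rows) _ ⟩
  sum (map G rows) + sum (map G (columns ++ _))
    ≡⟨ cong (sum (map G rows) +_) (trans (cong sum (map-++ G columns _)) (sum-++ (map G columns) _)) ⟩
  sum (map G rows) + (sum (map G columns) + (F (suc h + k) m + 0))
    ≡⟨ cong₂ (λ x y → x + (y + (F (suc h + k) m + 0))) (sum-G-upTo (λ i → suc i , suc (suc k)) (suc h)) (sum-G-upTo (λ j → 2 , suc j) k) ⟩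
  sumUpTo (λ i → F (i + suc k) m) (suc h) + (sumUpTo (λ j → F (suc j) m) k + (F (suc h + k) m + 0))
    ≡⟨ rearrange (sumUpTo (λ i → F (i + suc k) m) (suc h)) (sumUpTo (λ j → F (suc j) m) k) (F (suc h + k) m) ⟩
  sumUpTo (λ j → F (suc j) m) k + sumUpTo (λ i → F (i + suc k) m) (suc h) + F (suc h + k) m
    ≡⟨ cong (λ x → sumUpTo (λ j → F (suc j) m) k + x + F (suc h + k) m)
            (sumUpTo-cong (suc h) (λ i _ → cong (λ j → F j m) (+-comm i (suc k)))) ⟩
  sumUpTo (λ j → F (suc j) m) k + sumUpTo (λ i → F (suc (k + i)) m) (suc h) + F (suc h + k) m
    ≡⟨ cong (_+ F (suc h + k) m) (sumUpTo-+-split k (suc h) (λ j → F (suc j) m)) ⟨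
  sumUpTo (λ j → F (suc j) m) (k + suc h) + F (suc h + k) m
    ≡⟨ cong (λ x → sumUpTo (λ j → F (suc j) m) x + F (suc h + k) m) (trans (+-suc k h) (cong suc (+-comm k h))) ⟩
  F (h + k) (suc m) ∎
  where
  G : ℕ × ℕ → ℕ
  G hk = F (collapse hk) m
  rows    = map (λ i → suc i , suc (suc k)) (upTo (suc h))
  columns = map (λ j → 2 , suc j) (upTo k)
  sum-G-upTo : ∀ (f : ℕ → ℕ × ℕ) n → sum (map G (map f (upTo n))) ≡ sumUpTo (G ∘ f) n
  sum-G-upTo f n = trans (cong sum (sym (map-∘ (upTo n)))) (sum-map-upTo (G ∘ f) n)
  rearrange : ∀ x y z → x + (y + (z + 0)) ≡ y + x + z
  rearrange = solve-∀

-- the number of depth-m descendants of s in the generating tree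
weight : ℕ → Slicing → ℕ
weight m s = F (collapse (labelOf s)) m

sum-weight-children : ∀ m p → Schroder p → sum (map (weight m) (children p)) ≡ weight (suc m) p
sum-weight-children m p S@(b , _) = begin
  sum (map (weight m) (children p))
    ≡⟨ cong sum (Pointwise-≡⇒≡ (Pointwise.map⁺ (weight m) G
         (Pointwise.map (λ (Sc , lab) → cong G (Label⇒labelOf Sc lab)) (children-labels p S)))) ⟩
  sum (map G (newSch (maxRowWidth p) (rightColHeight p)))
    ≡⟨ sum-newSch m (⊓-glb (1≤topRowWidth p (baxter⇒TopRow b)) (s≤s z≤n)) (1≤rightColHeight b) ⟩
  weight (suc m) p ∎
  where
  G : ℕ × ℕ → ℕ
  G hk = F (collapse hk) m

sum-weight-concatMap : ∀ m ps → All Schroder ps →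
  sum (map (weight m) (concatMap children ps)) ≡ sum (map (weight (suc m)) ps)
sum-weight-concatMap m []       []       = refl
sum-weight-concatMap m (p ∷ ps) (S ∷ Ss) = begin
  sum (map (weight m) (children p ++ concatMap children ps))
    ≡⟨ cong sum (map-++ (weight m) (children p) _) ⟩
  sum (map (weight m) (children p) ++ map (weight m) (concatMap children ps))
    ≡⟨ sum-++ (map (weight m) (children p)) _ ⟩
  sum (map (weight m) (children p)) + sum (map (weight m) (concatMap children ps))
    ≡⟨ cong₂ _+_ (sum-weight-children m p S) (sum-weight-concatMap m ps Ss) ⟩
  weight (suc m) p + sum (map (weight (suc m)) ps) ∎

sum-weight-level : ∀ n m → sum (map (weight m) (level n)) ≡ F 0 (n + m)
sum-weight-level zero    m = +-identityʳ (F 0 m)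
sum-weight-level (suc n) m = begin
  sum (map (weight m) (level (suc n)))    ≡⟨ sum-weight-concatMap m (level n) (All.tabulate (proj₁ ∘ level-sound n _)) ⟩
  sum (map (weight (suc m)) (level n))    ≡⟨ sum-weight-level n (suc m) ⟩
  F 0 (n + suc m)                         ≡⟨ cong (F 0) (+-suc n m) ⟩
  F 0 (suc n + m)                         ∎

length-level : ∀ n → length (level n) ≡ LargeSchroder (suc n)
length-level n = begin
  length (level n)                  ≡⟨ length≡sum-weight₀ (level n) ⟩
  sum (map (weight 0) (level n))    ≡⟨ sum-weight-level n 0 ⟩
  F 0 (n + 0)                       ≡⟨ cong (F 0) (+-identityʳ n) ⟩
  F 0 n                             ≡⟨ LargeSchroder≡F₀ n ⟨
  LargeSchroder (suc n)             ∎
  where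
  length≡sum-weight₀ : ∀ xs → length xs ≡ sum (map (weight 0) xs)
  length≡sum-weight₀ []       = refl
  length≡sum-weight₀ (x ∷ xs) = cong suc (length≡sum-weight₀ xs)

theorem5 : Label cell 1 1
    × (∀ P → Schroder P →
    ∃[ h ] ∃[ k ] (Label P h k
    × (∃[ cs ] ∃[ L ]
    ( Unique cs
    × (∀ c → (c ∈ cs) ⇔ (Schroder c × GrowsFrom P c))
    × Pointwise (λ c hk → Label c (proj₁ hk) (proj₂ hk)) cs L
    × L ↭ newSch h k))))
    × (∀ n → 1 ≤ n →
    ∃[ xs ] ( Unique xs
    × (∀ s → (s ∈ xs) ⇔ (Schroder s × size s ≡ n))
    × length xs ≡ LargeSchroder n))
theorem5 =
    label cell (cellB , [])
  , (λ P S → maxRowWidth P , rightColHeight P , label P S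
           , children P , newSch (maxRowWidth P) (rightColHeight P)
           , children-unique P , ∈-children⇔ P S , Pointwise.map proj₂ (children-labels P S) , ↭-refl)
  , λ { (suc n) _ → level n , level-unique n , ∈-level⇔ n , length-level n }
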